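{- Let $m\ge1$ and $0\le t\le m$ be integers, and let $f^{\pm}(x,t,m)=\sum_{n=0}^{2m-1}a^{\pm}(n,t,m)x^n$. Then, as rational functions of $x$, \[f^+(x,t,m)=\frac{1-x^m}{1-x}\left(\frac{x(1-x^{m-t})}{1-x}-\frac{x^{m-t+1}(1-x^{t-1})}{1-x}+(t-1)x^m+t\right),\] and \[f^-(x,t,m)=\frac{1-x^m}{1-x}\left(\frac{x^{t+1}(1-x^{m-t})}{1-x}-\frac{x(1-x^{t})}{1-x}+tx^m+t\right).\]
   Context: For a positive integer $m$ let $\varphi_m(u)=\min_{n\in\mathbb{Z}}|u-2nm|$ for $u\in\mathbb{Z}$ (so $\varphi_m$ is $2m$-periodic, even, and $\varphi_m(u)=u$ for $0\le u\le m$). The positive and negative circular sequences with first term $t$ and height $m$ are $a^+(n,t,m)=\varphi_m(t+n)$ and $a^-(n,t,m)=\varphi_m(t-n)$, $n\ge0$. -}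

module Defs where

open import Data.Nat as ℕ using (ℕ; zero; suc)
open import Data.Integer as ℤ using (ℤ; +_; -[1+_]; _%ℕ_)
open import Data.Rational as ℚ using (ℚ; 0ℚ; 1ℚ; _+_; _*_; _-_; ≢-nonZero; 1/_)
open import Data.Rational.Properties using (+-*-commutativeRing)
open import Data.List using (List; map; upTo; foldr)
open import Function using (_∘_)
open import Relation.Nullary using (¬_)
open import Relation.Binary.PropositionalEquality using (_≡_; _≢_; sym)
open import Algebra.Bundles using (CommutativeRing)
import Algebra.Properties.Group as GroupProperties

-- φ_m(u) = min_{n∈ℤ} |u - 2nm|.  For m ≥ 1 this is computed from r = u mod 2m
-- as min(r, 2m - r); for m = 0 every term equals |u|.
φ : ℕ → ℤ → ℕ
φ zero u = ℤ.∣ u ∣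
φ (suc k) u = ℕ._⊓_ r (ℕ._∸_ (ℕ._*_ 2 (suc k)) r)
  where r = u %ℕ (ℕ._*_ 2 (suc k))

a⁺ : ℕ → ℕ → ℕ → ℕ
a⁺ n t m = φ m (ℤ._+_ (+ t) (+ n))

a⁻ : ℕ → ℕ → ℕ → ℕ
a⁻ n t m = φ m (ℤ._-_ (+ t) (+ n))

infixr 8 _^_
_^_ : ℚ → ℕ → ℚ
x ^ zero = 1ℚ
x ^ suc n = x * (x ^ n)

ipow : (x : ℚ) → x ≢ 0ℚ → ℤ → ℚ
ipow x x≢0 (+ n) = x ^ n
ipow x x≢0 -[1+ n ] = (1/ x) ^ suc n
  where instance _ = ≢-nonZero x≢0

divBy : (p q : ℚ) → q ≢ 0ℚ → ℚ
divBy p q q≢0 = p * (1/ q)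
  where instance _ = ≢-nonZero q≢0

1-x≢0 : ∀ {x} → x ≢ 1ℚ → 1ℚ - x ≢ 0ℚ
1-x≢0 {x} x≢1 e = x≢1 (sym (GroupProperties.x∙y⁻¹≈ε⇒x≈y +-group 1ℚ x e))
  where open CommutativeRing +-*-commutativeRing using (+-group)

ℕtoℚ : ℕ → ℚ
ℕtoℚ k = (+ k) ℚ./ 1

sumℚ : List ℚ → ℚ
sumℚ = foldr _+_ 0ℚ

f⁺ : ℚ → ℕ → ℕ → ℚ
f⁺ x t m = sumℚ (map (λ n → ℕtoℚ (a⁺ n t m) * (x ^ n)) (upTo (ℕ._*_ 2 m)))

f⁻ : ℚ → ℕ → ℕ → ℚ
f⁻ x t m = sumℚ (map (λ n → ℕtoℚ (a⁻ n t m) * (x ^ n)) (upTo (ℕ._*_ 2 m)))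

-- Write poly d g x for ∑_{n<d} g(n) xⁿ. A finite sum of an arithmetic progression
-- satisfies (1-x)² poly = (linear terms), because shifting the index by one changes
-- the sum by a geometric series. One period of φ_m splits at m into a rising and a
-- falling progression, which gives (1-x)² Σ_{n<2m} φ_m(n) xⁿ = x (1-xᵐ)². Rotating a
-- 2m-periodic sequence by k gives
--   poly 2m g x = (1 - x²ᵐ) poly k g x + xᵏ poly 2m (g ∘ (k +_)) x.
-- For a⁺ rotate by m - t, so that the prefix t, t+1, …, m-1 is a progression and the
-- rest is φ_m started at its peak; for a⁻ rotate by t, so that the prefix t, t-1, …, 1
-- is a progression and the rest is φ_m itself. This computes (1-x)² f^±, and the
-- theorem follows by cancelling (1-x)².
module Submission where

open import Defs
open import Data.Nat using (ℕ; _≤_)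
open import Data.Integer using (+_)
open import Data.Integer as ℤ using ()
open import Data.Rational using (ℚ; 0ℚ; 1ℚ; _+_; _*_; _-_; _/_)
open import Data.Product using (_×_; _,_)
open import Relation.Binary.PropositionalEquality using (_≡_; _≢_)

open import Data.Nat as ℕ using (zero; suc; _<_; _∸_; _⊓_; z≤n; s≤s)
import Data.Nat.Properties as ℕₚ
open import Data.Nat.DivMod using (m<n⇒m%n≡m; %-remove-+ˡ)
open import Data.Nat.Divisibility using (∣-refl)
import Data.Integer.Properties as ℤₚ
open import Data.Rational using (-_; 1/_; toℚᵘ; NonZero; ≢-nonZero)
import Data.Rational.Properties as ℚₚ
import Data.Rational.Unnormalised as ℚᵘ
import Data.Rational.Unnormalised.Properties as ℚᵘₚ
open import Data.List using (_∷_; []; map; applyUpTo; upTo)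
open import Function using (_∘_)
open import Level using (0ℓ)
import Algebra.Properties.CommutativeSemigroup as CommutativeSemigroup
open import Algebra.Bundles using (CommutativeMonoid)
open import Relation.Nullary.Decidable using (dec⇒maybe)
open import Relation.Binary.PropositionalEquality using (refl; sym; trans; cong; cong₂; subst; module ≡-Reasoning)
open import Tactic.RingSolver using (solve; solve-∀)
open import Tactic.RingSolver.Core.AlmostCommutativeRing using (AlmostCommutativeRing; fromCommutativeRing)

open CommutativeSemigroup (CommutativeMonoid.commutativeSemigroup ℚₚ.+-0-commutativeMonoid)
  using () renaming (interchange to +-interchange)
open CommutativeSemigroup (CommutativeMonoid.commutativeSemigroup ℚₚ.*-1-commutativeMonoid)
  using () renaming (x∙yz≈y∙xz to x*yz≡y*xz)
open CommutativeSemigroup ℕₚ.+-commutativeSemigroup using () renaming (x∙yz≈y∙xz to x+yz≡y+xz)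

-- The zero test lets the ring solver drop cancelled monomials from its normal forms.
ℚ-ring : AlmostCommutativeRing 0ℓ 0ℓ
ℚ-ring = fromCommutativeRing ℚₚ.+-*-commutativeRing (λ q → dec⇒maybe (0ℚ ℚₚ.≟ q))

[i+j]/1≡i/1+j/1 : ∀ i j → (i ℤ.+ j) / 1 ≡ i / 1 + j / 1
[i+j]/1≡i/1+j/1 i j = ℚₚ.toℚᵘ-injective (begin
  toℚᵘ ((i ℤ.+ j) / 1)                ≈⟨ ℚₚ.toℚᵘ-fromℚᵘ (ℚᵘ.mkℚᵘ (i ℤ.+ j) 0) ⟩
  ℚᵘ.mkℚᵘ (i ℤ.+ j) 0                  ≈⟨ ℚᵘ.*≡* (cong₂ (λ a b → (a ℤ.+ b) ℤ.* + 1) (sym (ℤₚ.*-identityʳ i)) (sym (ℤₚ.*-identityʳ j))) ⟩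
  ℚᵘ.mkℚᵘ i 0 ℚᵘ.+ ℚᵘ.mkℚᵘ j 0         ≈⟨ ℚᵘₚ.+-cong (ℚᵘₚ.≃-sym (ℚₚ.toℚᵘ-fromℚᵘ (ℚᵘ.mkℚᵘ i 0))) (ℚᵘₚ.≃-sym (ℚₚ.toℚᵘ-fromℚᵘ (ℚᵘ.mkℚᵘ j 0))) ⟩
  toℚᵘ (i / 1) ℚᵘ.+ toℚᵘ (j / 1)       ≈⟨ ℚᵘₚ.≃-sym (ℚₚ.toℚᵘ-homo-+ (i / 1) (j / 1)) ⟩
  toℚᵘ (i / 1 + j / 1)                 ∎)
  where open ℚᵘₚ.≃-Reasoning

ℕtoℚ-suc : ∀ n → ℕtoℚ (suc n) ≡ ℕtoℚ n + 1ℚ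
ℕtoℚ-suc n = trans ([i+j]/1≡i/1+j/1 (+ 1) (+ n)) (ℚₚ.+-comm 1ℚ (ℕtoℚ n))

∑ : ℕ → (ℕ → ℚ) → ℚ
∑ zero    f = 0ℚ
∑ (suc n) f = f 0 + ∑ n (f ∘ suc)

sumℚ-map-upTo : ∀ (f : ℕ → ℚ) n → sumℚ (map f (upTo n)) ≡ ∑ n f
sumℚ-map-upTo f n = sumℚ-map-applyUpTo f (λ i → i) n
  where
  sumℚ-map-applyUpTo : ∀ (f : ℕ → ℚ) (g : ℕ → ℕ) n → sumℚ (map f (applyUpTo g n)) ≡ ∑ n (f ∘ g)
  sumℚ-map-applyUpTo f g zero    = refl
  sumℚ-map-applyUpTo f g (suc n) = cong (_+_ (f (g 0))) (sumℚ-map-applyUpTo f (g ∘ suc) n)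

∑-cong : ∀ n {f g : ℕ → ℚ} → (∀ i → i < n → f i ≡ g i) → ∑ n f ≡ ∑ n g
∑-cong zero    f≗g = refl
∑-cong (suc n) f≗g = cong₂ _+_ (f≗g 0 (s≤s z≤n)) (∑-cong n (λ i i<n → f≗g (suc i) (s≤s i<n)))

∑-distrib-+ : ∀ n (f g : ℕ → ℚ) → ∑ n (λ i → f i + g i) ≡ ∑ n f + ∑ n g
∑-distrib-+ zero    f g = refl
∑-distrib-+ (suc n) f g =
  trans (cong (_+_ (f 0 + g 0)) (∑-distrib-+ n (f ∘ suc) (g ∘ suc)))
        (+-interchange (f 0) (g 0) (∑ n (f ∘ suc)) (∑ n (g ∘ suc)))

∑-*ˡ : ∀ n c (f : ℕ → ℚ) → ∑ n (λ i → c * f i) ≡ c * ∑ n f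
∑-*ˡ zero    c f = sym (ℚₚ.*-zeroʳ c)
∑-*ˡ (suc n) c f = trans (cong (_+_ (c * f 0)) (∑-*ˡ n c (f ∘ suc))) (sym (ℚₚ.*-distribˡ-+ c (f 0) _))

∑-split : ∀ a b (f : ℕ → ℚ) → ∑ (a ℕ.+ b) f ≡ ∑ a f + ∑ b (λ i → f (a ℕ.+ i))
∑-split zero    b f = sym (ℚₚ.+-identityˡ _)
∑-split (suc a) b f = trans (cong (_+_ (f 0)) (∑-split a b (f ∘ suc))) (sym (ℚₚ.+-assoc (f 0) _ _))

^-distribˡ-+-* : ∀ x a b → x ^ (a ℕ.+ b) ≡ x ^ a * x ^ b
^-distribˡ-+-* x zero    b = sym (ℚₚ.*-identityˡ (x ^ b))
^-distribˡ-+-* x (suc a) b = trans (cong (x *_) (^-distribˡ-+-* x a b)) (sym (ℚₚ.*-assoc x (x ^ a) (x ^ b)))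

poly : ℕ → (ℕ → ℚ) → ℚ → ℚ
poly d g x = ∑ d (λ n → g n * x ^ n)

poly-cong : ∀ d {g h : ℕ → ℚ} x → (∀ n → n < d → g n ≡ h n) → poly d g x ≡ poly d h x
poly-cong d x g≗h = ∑-cong d (λ n n<d → cong (_* x ^ n) (g≗h n n<d))

poly-split : ∀ a b (g : ℕ → ℚ) x →
  poly (a ℕ.+ b) g x ≡ poly a g x + x ^ a * poly b (λ n → g (a ℕ.+ n)) x
poly-split a b g x =
  trans (∑-split a b _) (cong (_+_ (poly a g x)) (trans (∑-cong b (λ n _ → factor n)) (∑-*ˡ b (x ^ a) _)))
  where
  factor : ∀ n → g (a ℕ.+ n) * x ^ (a ℕ.+ n) ≡ x ^ a * (g (a ℕ.+ n) * x ^ n)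
  factor n = trans (cong (g (a ℕ.+ n) *_) (^-distribˡ-+-* x a n)) (x*yz≡y*xz (g (a ℕ.+ n)) (x ^ a) (x ^ n))

poly-shift : ∀ d (g : ℕ → ℚ) x → x * poly d (g ∘ suc) x + g 0 ≡ poly d g x + g d * x ^ d
poly-shift d g x = begin
  x * poly d (g ∘ suc) x + g 0                      ≡⟨ as-poly-1 (g 0) x (poly d (g ∘ suc) x) ⟩
  poly 1 g x + x ^ 1 * poly d (g ∘ suc) x           ≡⟨ poly-split 1 d g x ⟨
  poly (1 ℕ.+ d) g x                                ≡⟨ cong (λ n → poly n g x) (ℕₚ.+-comm 1 d) ⟩
  poly (d ℕ.+ 1) g x                                ≡⟨ poly-split d 1 g x ⟩
  poly d g x + x ^ d * poly 1 (λ n → g (d ℕ.+ n)) x ≡⟨ cong (λ n → poly d g x + x ^ d * (g n * 1ℚ + 0ℚ)) (ℕₚ.+-identityʳ d) ⟩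
  poly d g x + x ^ d * (g d * 1ℚ + 0ℚ)              ≡⟨ from-poly-1 (poly d g x) (x ^ d) (g d) ⟩
  poly d g x + g d * x ^ d                          ∎
  where
  open ≡-Reasoning
  as-poly-1 : ∀ a x p → x * p + a ≡ (a * 1ℚ + 0ℚ) + x * 1ℚ * p
  as-poly-1 = solve-∀ ℚ-ring
  from-poly-1 : ∀ p X a → p + X * (a * 1ℚ + 0ℚ) ≡ p + a * X
  from-poly-1 = solve-∀ ℚ-ring

poly-geometric : ∀ d x → (1ℚ - x) * poly d (λ _ → 1ℚ) x ≡ 1ℚ - x ^ d
poly-geometric d x = telescope x (poly d (λ _ → 1ℚ) x) (x ^ d) (poly-shift d (λ _ → 1ℚ) x)
  where
  telescope : ∀ x G X → x * G + 1ℚ ≡ G + 1ℚ * X → (1ℚ - x) * G ≡ 1ℚ - X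
  telescope x G X shift = begin
    (1ℚ - x) * G             ≡⟨ solve (x ∷ G ∷ X ∷ []) ℚ-ring ⟩
    (G + 1ℚ * X) - x * G - X ≡⟨ cong (λ z → z - x * G - X) shift ⟨
    (x * G + 1ℚ) - x * G - X ≡⟨ solve (x ∷ G ∷ X ∷ []) ℚ-ring ⟩
    1ℚ - X                   ∎
    where open ≡-Reasoning

poly-arithmetic : ∀ d (g : ℕ → ℚ) b x → (∀ n → n < d → g (suc n) ≡ g n + b) →
  (1ℚ - x) * (1ℚ - x) * poly d g x ≡ (1ℚ - x) * (g 0 - g d * x ^ d) + b * x * (1ℚ - x ^ d)
poly-arithmetic d g b x step =
  combine x (poly d g x) (poly d (g ∘ suc) x) (poly d (λ _ → 1ℚ) x) (g 0) (g d) (x ^ d) b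
          (poly-shift d g x) shifted (poly-geometric d x)
  where
  open ≡-Reasoning
  split-term : ∀ a b X → (a + b) * X ≡ a * X + b * (1ℚ * X)
  split-term = solve-∀ ℚ-ring
  shifted : poly d (g ∘ suc) x ≡ poly d g x + b * poly d (λ _ → 1ℚ) x
  shifted = begin
    poly d (g ∘ suc) x                        ≡⟨ ∑-cong d (λ n n<d → trans (cong (_* x ^ n) (step n n<d)) (split-term (g n) b (x ^ n))) ⟩
    ∑ d (λ n → g n * x ^ n + b * (1ℚ * x ^ n)) ≡⟨ ∑-distrib-+ d _ _ ⟩
    poly d g x + ∑ d (λ n → b * (1ℚ * x ^ n)) ≡⟨ cong (_+_ (poly d g x)) (∑-*ˡ d b _) ⟩
    poly d g x + b * poly d (λ _ → 1ℚ) x      ∎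
  combine : ∀ x S S′ G g₀ g₁ X b → x * S′ + g₀ ≡ S + g₁ * X → S′ ≡ S + b * G → (1ℚ - x) * G ≡ 1ℚ - X →
    (1ℚ - x) * (1ℚ - x) * S ≡ (1ℚ - x) * (g₀ - g₁ * X) + b * x * (1ℚ - X)
  combine x S S′ G g₀ g₁ X b shift S′≡ geometric = begin
    (1ℚ - x) * (1ℚ - x) * S                              ≡⟨ solve (x ∷ S ∷ g₁ ∷ X ∷ []) ℚ-ring ⟩
    (1ℚ - x) * ((S + g₁ * X) - x * S - g₁ * X)           ≡⟨ cong (λ z → (1ℚ - x) * (z - x * S - g₁ * X)) shift ⟨
    (1ℚ - x) * ((x * S′ + g₀) - x * S - g₁ * X)          ≡⟨ cong (λ z → (1ℚ - x) * ((x * z + g₀) - x * S - g₁ * X)) S′≡ ⟩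
    (1ℚ - x) * ((x * (S + b * G) + g₀) - x * S - g₁ * X) ≡⟨ solve (x ∷ S ∷ G ∷ g₀ ∷ g₁ ∷ X ∷ b ∷ []) ℚ-ring ⟩
    (1ℚ - x) * (g₀ - g₁ * X) + b * x * ((1ℚ - x) * G)    ≡⟨ cong (λ z → (1ℚ - x) * (g₀ - g₁ * X) + b * x * z) geometric ⟩
    (1ℚ - x) * (g₀ - g₁ * X) + b * x * (1ℚ - X)          ∎

poly-ascending : ∀ a d x → (1ℚ - x) * (1ℚ - x) * poly d (λ n → ℕtoℚ (a ℕ.+ n)) x
                         ≡ (1ℚ - x) * (ℕtoℚ a - ℕtoℚ (a ℕ.+ d) * x ^ d) + x * (1ℚ - x ^ d)
poly-ascending a d x =
  trans (poly-arithmetic d (λ n → ℕtoℚ (a ℕ.+ n)) 1ℚ x (λ n _ → trans (cong ℕtoℚ (ℕₚ.+-suc a n)) (ℕtoℚ-suc (a ℕ.+ n))))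
        (cong₂ (λ i c → (1ℚ - x) * (ℕtoℚ i - ℕtoℚ (a ℕ.+ d) * x ^ d) + c * (1ℚ - x ^ d))
               (ℕₚ.+-identityʳ a) (ℚₚ.*-identityˡ x))

poly-descending : ∀ d x → (1ℚ - x) * (1ℚ - x) * poly d (λ n → ℕtoℚ (d ∸ n)) x
                        ≡ (1ℚ - x) * ℕtoℚ d - x * (1ℚ - x ^ d)
poly-descending d x = begin
  (1ℚ - x) * (1ℚ - x) * poly d (λ n → ℕtoℚ (d ∸ n)) x
    ≡⟨ poly-arithmetic d (λ n → ℕtoℚ (d ∸ n)) (- 1ℚ) x (λ n n<d → predecessor (trans (cong ℕtoℚ (ℕₚ.+-∸-assoc 1 n<d)) (ℕtoℚ-suc (d ∸ suc n)))) ⟩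
  (1ℚ - x) * (ℕtoℚ d - ℕtoℚ (d ∸ d) * x ^ d) + - 1ℚ * x * (1ℚ - x ^ d)
    ≡⟨ cong (λ i → (1ℚ - x) * (ℕtoℚ d - ℕtoℚ i * x ^ d) + - 1ℚ * x * (1ℚ - x ^ d)) (ℕₚ.n∸n≡0 d) ⟩
  (1ℚ - x) * (ℕtoℚ d - 0ℚ * x ^ d) + - 1ℚ * x * (1ℚ - x ^ d)
    ≡⟨ tidy (ℕtoℚ d) x (x ^ d) ⟩
  (1ℚ - x) * ℕtoℚ d - x * (1ℚ - x ^ d) ∎
  where
  open ≡-Reasoning
  predecessor : ∀ {p q} → p ≡ q + 1ℚ → q ≡ p + - 1ℚ
  predecessor {p} {q} p≡q+1 = begin
    q             ≡⟨ solve (q ∷ []) ℚ-ring ⟩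
    q + 1ℚ + - 1ℚ ≡⟨ cong (_+ - 1ℚ) p≡q+1 ⟨
    p + - 1ℚ      ∎
  tidy : ∀ D x X → (1ℚ - x) * (D - 0ℚ * X) + - 1ℚ * x * (1ℚ - X) ≡ (1ℚ - x) * D - x * (1ℚ - X)
  tidy = solve-∀ ℚ-ring

poly-rotate : ∀ d k (g : ℕ → ℚ) x → (∀ n → n < k → g (d ℕ.+ n) ≡ g n) →
  poly d g x ≡ (1ℚ - x ^ d) * poly k g x + x ^ k * poly d (λ n → g (k ℕ.+ n)) x
poly-rotate d k g x periodic =
  solve-for-S (poly d g x) (poly k g x) (poly d (λ n → g (k ℕ.+ n)) x) (x ^ d) (x ^ k) (begin
  poly k g x + x ^ k * poly d (λ n → g (k ℕ.+ n)) x ≡⟨ poly-split k d g x ⟨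
  poly (k ℕ.+ d) g x                                ≡⟨ cong (λ n → poly n g x) (ℕₚ.+-comm k d) ⟩
  poly (d ℕ.+ k) g x                                ≡⟨ poly-split d k g x ⟩
  poly d g x + x ^ d * poly k (λ n → g (d ℕ.+ n)) x ≡⟨ cong (λ p → poly d g x + x ^ d * p) (poly-cong k x periodic) ⟩
  poly d g x + x ^ d * poly k g x                   ∎)
  where
  open ≡-Reasoning
  solve-for-S : ∀ S P R X Y → P + Y * R ≡ S + X * P → S ≡ (1ℚ - X) * P + Y * R
  solve-for-S S P R X Y e = begin
    S                       ≡⟨ solve (S ∷ P ∷ X ∷ []) ℚ-ring ⟩
    (S + X * P) - X * P     ≡⟨ cong (λ z → z - X * P) e ⟨
    (P + Y * R) - X * P     ≡⟨ solve (P ∷ R ∷ X ∷ Y ∷ []) ℚ-ring ⟩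
    (1ℚ - X) * P + Y * R    ∎

*-distribˡ-+-scaled : ∀ c A X B → c * (A + X * B) ≡ c * A + X * (c * B)
*-distribˡ-+-scaled c A X B = trans (ℚₚ.*-distribˡ-+ c A (X * B)) (cong (_+_ (c * A)) (x*yz≡y*xz c X B))

*-distribˡ-combination : ∀ c U A V B → c * (U * A + V * B) ≡ U * (c * A) + V * (c * B)
*-distribˡ-combination c U A V B =
  trans (ℚₚ.*-distribˡ-+ c (U * A) (V * B)) (cong₂ _+_ (x*yz≡y*xz c U A) (x*yz≡y*xz c V B))

+m-+n≡+[m∸n] : ∀ {a b} → b ≤ a → + a ℤ.- + b ≡ + (a ∸ b)
+m-+n≡+[m∸n] {a} {b} b≤a = trans (ℤₚ.[+m]-[+n]≡m⊖n a b) (ℤₚ.⊖-≥ b≤a)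

+m-+n≡-[n∸m] : ∀ {a b} → a ≤ b → + a ℤ.- + b ≡ ℤ.- + (b ∸ a)
+m-+n≡-[n∸m] {a} {b} a≤b = trans (ℤₚ.[+m]-[+n]≡m⊖n a b) (ℤₚ.⊖-≤ a≤b)

[m+n]∸o≡m∸[o∸n] : ∀ m {n o} → n ≤ o → m ℕ.+ n ∸ o ≡ m ∸ (o ∸ n)
[m+n]∸o≡m∸[o∸n] m {n} {o} n≤o = begin
  m ℕ.+ n ∸ o               ≡⟨ cong (m ℕ.+ n ∸_) (ℕₚ.m+[n∸m]≡n n≤o) ⟨
  m ℕ.+ n ∸ (n ℕ.+ (o ∸ n)) ≡⟨ ℕₚ.∸-+-assoc (m ℕ.+ n) n (o ∸ n) ⟨
  m ℕ.+ n ∸ n ∸ (o ∸ n)     ≡⟨ cong (_∸ (o ∸ n)) (ℕₚ.m+n∸n≡m m n) ⟩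
  m ∸ (o ∸ n)               ∎
  where open ≡-Reasoning

triangle : ℕ → ℕ → ℚ
triangle m n = ℕtoℚ (φ m (+ n))

module _ (k : ℕ) where
  private
    m : ℕ
    m = suc k

  2m≡m+m : 2 ℕ.* m ≡ m ℕ.+ m
  2m≡m+m = cong (m ℕ.+_) (ℕₚ.+-identityʳ m)

  φ-below-2m : ∀ {n} → n < 2 ℕ.* m → φ m (+ n) ≡ n ⊓ (m ℕ.+ m ∸ n)
  φ-below-2m {n} n<2m rewrite m<n⇒m%n≡m n<2m = cong (λ d → n ⊓ (d ∸ n)) 2m≡m+m

  φ-≤ : ∀ {n} → n ≤ m → φ m (+ n) ≡ n
  φ-≤ {n} n≤m = begin
    φ m (+ n)          ≡⟨ φ-below-2m (subst (n <_) (sym 2m≡m+m) (ℕₚ.≤-<-trans n≤m (ℕₚ.m<m+n m (s≤s z≤n)))) ⟩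
    n ⊓ (m ℕ.+ m ∸ n)  ≡⟨ ℕₚ.m≤n⇒m⊓n≡m (subst (n ≤_) (sym (ℕₚ.+-∸-assoc m n≤m)) (ℕₚ.≤-trans n≤m (ℕₚ.m≤m+n m (m ∸ n)))) ⟩
    n                  ∎
    where open ≡-Reasoning

  φ-m+ : ∀ {n} → n < m → φ m (+ (m ℕ.+ n)) ≡ m ∸ n
  φ-m+ {n} n<m = begin
    φ m (+ (m ℕ.+ n))                     ≡⟨ φ-below-2m (subst (m ℕ.+ n <_) (sym 2m≡m+m) (ℕₚ.+-monoʳ-< m n<m)) ⟩
    (m ℕ.+ n) ⊓ (m ℕ.+ m ∸ (m ℕ.+ n))     ≡⟨ cong ((m ℕ.+ n) ⊓_) (ℕₚ.[m+n]∸[m+o]≡n∸o m m n) ⟩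
    (m ℕ.+ n) ⊓ (m ∸ n)                   ≡⟨ ℕₚ.m≥n⇒m⊓n≡n (ℕₚ.≤-trans (ℕₚ.m∸n≤m m n) (ℕₚ.m≤m+n m n)) ⟩
    m ∸ n                                 ∎
    where open ≡-Reasoning

  φ-2m+ : ∀ n → φ m (+ (2 ℕ.* m ℕ.+ n)) ≡ φ m (+ n)
  φ-2m+ n = cong (λ r → r ⊓ (2 ℕ.* m ∸ r)) (%-remove-+ˡ n ∣-refl)

  φ-neg : ∀ {n} → n < 2 ℕ.* m → φ m (ℤ.- + n) ≡ φ m (+ n)
  φ-neg {zero}  _    = refl
  -- On -[1+ n ] the remainder _%ℕ_ branches on suc n % 2m, which is suc n here.
  φ-neg {suc n} n<2m with suc n ℕ.% (2 ℕ.* m) | m<n⇒m%n≡m n<2m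
  ... | .(suc n) | refl =
    trans (cong ((2 ℕ.* m ∸ suc n) ⊓_) (ℕₚ.m∸[m∸n]≡n (ℕₚ.<⇒≤ n<2m))) (ℕₚ.⊓-comm (2 ℕ.* m ∸ suc n) (suc n))

  φ-neg-2m∸ : ∀ {r} → 0 < r → r ≤ m → φ m (ℤ.- + (2 ℕ.* m ∸ r)) ≡ r
  φ-neg-2m∸ {r} 0<r r≤m = begin
    φ m (ℤ.- + (2 ℕ.* m ∸ r))  ≡⟨ φ-neg (ℕₚ.∸-monoʳ-< 0<r (ℕₚ.≤-trans r≤m (ℕₚ.m≤m+n m (m ℕ.+ 0)))) ⟩
    φ m (+ (2 ℕ.* m ∸ r))      ≡⟨ cong (λ s → φ m (+ s)) (trans (cong (_∸ r) 2m≡m+m) (ℕₚ.+-∸-assoc m r≤m)) ⟩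
    φ m (+ (m ℕ.+ (m ∸ r)))    ≡⟨ φ-m+ (ℕₚ.∸-monoʳ-< 0<r r≤m) ⟩
    m ∸ (m ∸ r)                ≡⟨ ℕₚ.m∸[m∸n]≡n r≤m ⟩
    r                          ∎
    where open ≡-Reasoning

  a⁻-≤ : ∀ {n t} → n ≤ t → t ≤ m → a⁻ n t m ≡ t ∸ n
  a⁻-≤ {n} {t} n≤t t≤m = trans (cong (φ m) (+m-+n≡+[m∸n] n≤t)) (φ-≤ (ℕₚ.≤-trans (ℕₚ.m∸n≤m t n) t≤m))

  a⁻-t+ : ∀ t {n} → n < 2 ℕ.* m → a⁻ (t ℕ.+ n) t m ≡ φ m (+ n)
  a⁻-t+ t {n} n<2m =
    trans (cong (φ m) (trans (+m-+n≡-[n∸m] (ℕₚ.m≤m+n t n)) (cong (λ s → ℤ.- + s) (ℕₚ.m+n∸m≡n t n))))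
          (φ-neg n<2m)

  a⁻-2m+ : ∀ {n t} → n < t → t ≤ m → a⁻ (2 ℕ.* m ℕ.+ n) t m ≡ a⁻ n t m
  a⁻-2m+ {n} {t} n<t t≤m = begin
    φ m (+ t ℤ.- + (2m ℕ.+ n))  ≡⟨ cong (φ m) (+m-+n≡-[n∸m] t≤2m+n) ⟩
    φ m (ℤ.- + (2m ℕ.+ n ∸ t))  ≡⟨ cong (λ s → φ m (ℤ.- + s)) ([m+n]∸o≡m∸[o∸n] 2m (ℕₚ.<⇒≤ n<t)) ⟩
    φ m (ℤ.- + (2m ∸ (t ∸ n)))  ≡⟨ φ-neg-2m∸ (ℕₚ.m<n⇒0<n∸m n<t) (ℕₚ.≤-trans (ℕₚ.m∸n≤m t n) t≤m) ⟩
    t ∸ n                       ≡⟨ a⁻-≤ (ℕₚ.<⇒≤ n<t) t≤m ⟨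
    a⁻ n t m                    ∎
    where
    open ≡-Reasoning
    2m : ℕ
    2m = 2 ℕ.* m
    t≤2m+n : t ≤ 2m ℕ.+ n
    t≤2m+n = ℕₚ.≤-trans t≤m (ℕₚ.≤-trans (ℕₚ.m≤m+n m (m ℕ.+ 0)) (ℕₚ.m≤m+n 2m n))

module _ (k : ℕ) (x : ℚ) where
  private
    m : ℕ
    m = suc k
    X M : ℚ
    X = x ^ m
    M = ℕtoℚ m

  x^2m≡X*X : x ^ (2 ℕ.* m) ≡ X * X
  x^2m≡X*X = trans (cong (x ^_) (2m≡m+m k)) (^-distribˡ-+-* x m m)

  poly-halves : ∀ g → poly (2 ℕ.* m) g x ≡ poly m g x + X * poly m (λ n → g (m ℕ.+ n)) x
  poly-halves g = trans (cong (λ d → poly d g x) (2m≡m+m k)) (poly-split m m g x)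

  poly-triangle-rising : (1ℚ - x) * (1ℚ - x) * poly m (triangle m) x ≡ (1ℚ - x) * (0ℚ - M * X) + x * (1ℚ - X)
  poly-triangle-rising =
    trans (cong ((1ℚ - x) * (1ℚ - x) *_) (poly-cong m x (λ n n<m → cong ℕtoℚ (φ-≤ k (ℕₚ.<⇒≤ n<m)))))
          (poly-ascending 0 m x)

  poly-triangle-falling : (1ℚ - x) * (1ℚ - x) * poly m (λ n → triangle m (m ℕ.+ n)) x ≡ (1ℚ - x) * M - x * (1ℚ - X)
  poly-triangle-falling =
    trans (cong ((1ℚ - x) * (1ℚ - x) *_) (poly-cong m x (λ n n<m → cong ℕtoℚ (φ-m+ k n<m))))
          (poly-descending m x)

  poly-triangle : (1ℚ - x) * (1ℚ - x) * poly (2 ℕ.* m) (triangle m) x ≡ x * (1ℚ - X) * (1ℚ - X)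
  poly-triangle = begin
    (1ℚ - x) * (1ℚ - x) * poly (2 ℕ.* m) (triangle m) x
      ≡⟨ cong ((1ℚ - x) * (1ℚ - x) *_) (poly-halves (triangle m)) ⟩
    (1ℚ - x) * (1ℚ - x) * (poly m (triangle m) x + X * poly m (λ n → triangle m (m ℕ.+ n)) x)
      ≡⟨ *-distribˡ-+-scaled ((1ℚ - x) * (1ℚ - x)) (poly m (triangle m) x) X (poly m (λ n → triangle m (m ℕ.+ n)) x) ⟩
    (1ℚ - x) * (1ℚ - x) * poly m (triangle m) x + X * ((1ℚ - x) * (1ℚ - x) * poly m (λ n → triangle m (m ℕ.+ n)) x)
      ≡⟨ cong₂ (λ a b → a + X * b) poly-triangle-rising poly-triangle-falling ⟩
    (1ℚ - x) * (0ℚ - M * X) + x * (1ℚ - X) + X * ((1ℚ - x) * M - x * (1ℚ - X))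
      ≡⟨ collect x X M ⟩
    x * (1ℚ - X) * (1ℚ - X) ∎
    where
    open ≡-Reasoning
    collect : ∀ x X M → (1ℚ - x) * (0ℚ - M * X) + x * (1ℚ - X) + X * ((1ℚ - x) * M - x * (1ℚ - X)) ≡ x * (1ℚ - X) * (1ℚ - X)
    collect = solve-∀ ℚ-ring

  poly-triangle-from-peak : (1ℚ - x) * (1ℚ - x) * poly (2 ℕ.* m) (λ n → triangle m (m ℕ.+ n)) x
                      ≡ (1ℚ - x) * M * (1ℚ - X * X) - x * (1ℚ - X) * (1ℚ - X)
  poly-triangle-from-peak = begin
    (1ℚ - x) * (1ℚ - x) * poly (2 ℕ.* m) (λ n → triangle m (m ℕ.+ n)) x
      ≡⟨ cong ((1ℚ - x) * (1ℚ - x) *_) (poly-halves (λ n → triangle m (m ℕ.+ n))) ⟩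
    (1ℚ - x) * (1ℚ - x) * (poly m (λ n → triangle m (m ℕ.+ n)) x + X * poly m (λ n → triangle m (m ℕ.+ (m ℕ.+ n))) x)
      ≡⟨ cong (λ p → (1ℚ - x) * (1ℚ - x) * (poly m (λ n → triangle m (m ℕ.+ n)) x + X * p)) (poly-cong m x (λ n _ → full-period n)) ⟩
    (1ℚ - x) * (1ℚ - x) * (poly m (λ n → triangle m (m ℕ.+ n)) x + X * poly m (triangle m) x)
      ≡⟨ *-distribˡ-+-scaled ((1ℚ - x) * (1ℚ - x)) (poly m (λ n → triangle m (m ℕ.+ n)) x) X (poly m (triangle m) x) ⟩
    (1ℚ - x) * (1ℚ - x) * poly m (λ n → triangle m (m ℕ.+ n)) x + X * ((1ℚ - x) * (1ℚ - x) * poly m (triangle m) x)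
      ≡⟨ cong₂ (λ a b → a + X * b) poly-triangle-falling poly-triangle-rising ⟩
    (1ℚ - x) * M - x * (1ℚ - X) + X * ((1ℚ - x) * (0ℚ - M * X) + x * (1ℚ - X))
      ≡⟨ collect x X M ⟩
    (1ℚ - x) * M * (1ℚ - X * X) - x * (1ℚ - X) * (1ℚ - X) ∎
    where
    open ≡-Reasoning
    full-period : ∀ n → triangle m (m ℕ.+ (m ℕ.+ n)) ≡ triangle m n
    full-period n = cong ℕtoℚ (trans (cong (λ i → φ m (+ i)) m+[m+n]≡2m+n) (φ-2m+ k n))
      where
      m+[m+n]≡2m+n : m ℕ.+ (m ℕ.+ n) ≡ 2 ℕ.* m ℕ.+ n
      m+[m+n]≡2m+n = trans (sym (ℕₚ.+-assoc m m n)) (cong (ℕ._+ n) (sym (2m≡m+m k)))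
    collect : ∀ x X M → (1ℚ - x) * M - x * (1ℚ - X) + X * ((1ℚ - x) * (0ℚ - M * X) + x * (1ℚ - X))
                      ≡ (1ℚ - x) * M * (1ℚ - X * X) - x * (1ℚ - X) * (1ℚ - X)
    collect = solve-∀ ℚ-ring

  f⁺-numerator : ∀ {t} → t ≤ m → (1ℚ - x) * (1ℚ - x) * f⁺ x t m
    ≡ (1ℚ - X * X) * ((1ℚ - x) * ℕtoℚ t + x * (1ℚ - x ^ (m ∸ t))) - x ^ (m ∸ t) * (x * (1ℚ - X) * (1ℚ - X))
  f⁺-numerator {t} t≤m = begin
    (1ℚ - x) * (1ℚ - x) * f⁺ x t m
      ≡⟨ cong ((1ℚ - x) * (1ℚ - x) *_) (trans (sumℚ-map-upTo (λ n → g n * x ^ n) (2 ℕ.* m)) (poly-rotate (2 ℕ.* m) (m ∸ t) g x periodic)) ⟩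
    (1ℚ - x) * (1ℚ - x) * ((1ℚ - x ^ (2 ℕ.* m)) * poly (m ∸ t) g x + D * B)
      ≡⟨ cong (λ Y → (1ℚ - x) * (1ℚ - x) * ((1ℚ - Y) * poly (m ∸ t) g x + D * B)) x^2m≡X*X ⟩
    (1ℚ - x) * (1ℚ - x) * ((1ℚ - X * X) * poly (m ∸ t) g x + D * B)
      ≡⟨ *-distribˡ-combination ((1ℚ - x) * (1ℚ - x)) (1ℚ - X * X) (poly (m ∸ t) g x) D B ⟩
    (1ℚ - X * X) * ((1ℚ - x) * (1ℚ - x) * poly (m ∸ t) g x) + D * ((1ℚ - x) * (1ℚ - x) * B)
      ≡⟨ cong₂ (λ a b → (1ℚ - X * X) * a + D * b) prefix rest ⟩
    (1ℚ - X * X) * ((1ℚ - x) * (T - M * D) + x * (1ℚ - D)) + D * ((1ℚ - x) * M * (1ℚ - X * X) - x * (1ℚ - X) * (1ℚ - X))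
      ≡⟨ collect x X D T M ⟩
    (1ℚ - X * X) * ((1ℚ - x) * T + x * (1ℚ - D)) - D * (x * (1ℚ - X) * (1ℚ - X)) ∎
    where
    open ≡-Reasoning
    g : ℕ → ℚ
    g n = triangle m (t ℕ.+ n)
    D T B : ℚ
    D = x ^ (m ∸ t)
    T = ℕtoℚ t
    B = poly (2 ℕ.* m) (λ n → g (m ∸ t ℕ.+ n)) x
    periodic : ∀ n → n < m ∸ t → g (2 ℕ.* m ℕ.+ n) ≡ g n
    periodic n _ = cong ℕtoℚ (trans (cong (λ i → φ m (+ i)) (x+yz≡y+xz t (2 ℕ.* m) n)) (φ-2m+ k (t ℕ.+ n)))
    rising : ∀ n → n < m ∸ t → g n ≡ ℕtoℚ (t ℕ.+ n)
    rising n n<m∸t = cong ℕtoℚ (φ-≤ k (subst (t ℕ.+ n ≤_) (ℕₚ.m+[n∸m]≡n t≤m) (ℕₚ.+-monoʳ-≤ t (ℕₚ.<⇒≤ n<m∸t))))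
    prefix : (1ℚ - x) * (1ℚ - x) * poly (m ∸ t) g x ≡ (1ℚ - x) * (T - M * D) + x * (1ℚ - D)
    prefix = trans (cong ((1ℚ - x) * (1ℚ - x) *_) (poly-cong (m ∸ t) x rising))
                   (trans (poly-ascending t (m ∸ t) x)
                          (cong (λ i → (1ℚ - x) * (T - ℕtoℚ i * D) + x * (1ℚ - D)) (ℕₚ.m+[n∸m]≡n t≤m)))
    peak-aligned : ∀ n → g (m ∸ t ℕ.+ n) ≡ triangle m (m ℕ.+ n)
    peak-aligned n = cong (triangle m) (trans (sym (ℕₚ.+-assoc t (m ∸ t) n)) (cong (ℕ._+ n) (ℕₚ.m+[n∸m]≡n t≤m)))
    rest : (1ℚ - x) * (1ℚ - x) * B ≡ (1ℚ - x) * M * (1ℚ - X * X) - x * (1ℚ - X) * (1ℚ - X)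
    rest = trans (cong ((1ℚ - x) * (1ℚ - x) *_) (poly-cong (2 ℕ.* m) x (λ n _ → peak-aligned n))) poly-triangle-from-peak
    collect : ∀ x X D T M → (1ℚ - X * X) * ((1ℚ - x) * (T - M * D) + x * (1ℚ - D)) + D * ((1ℚ - x) * M * (1ℚ - X * X) - x * (1ℚ - X) * (1ℚ - X))
                          ≡ (1ℚ - X * X) * ((1ℚ - x) * T + x * (1ℚ - D)) - D * (x * (1ℚ - X) * (1ℚ - X))
    collect = solve-∀ ℚ-ring

  f⁻-numerator : ∀ {t} → t ≤ m → (1ℚ - x) * (1ℚ - x) * f⁻ x t m
    ≡ (1ℚ - X * X) * ((1ℚ - x) * ℕtoℚ t - x * (1ℚ - x ^ t)) + x ^ t * (x * (1ℚ - X) * (1ℚ - X))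
  f⁻-numerator {t} t≤m = begin
    (1ℚ - x) * (1ℚ - x) * f⁻ x t m
      ≡⟨ cong ((1ℚ - x) * (1ℚ - x) *_) (trans (sumℚ-map-upTo (λ n → g n * x ^ n) (2 ℕ.* m)) (poly-rotate (2 ℕ.* m) t g x periodic)) ⟩
    (1ℚ - x) * (1ℚ - x) * ((1ℚ - x ^ (2 ℕ.* m)) * poly t g x + x ^ t * B)
      ≡⟨ cong (λ Y → (1ℚ - x) * (1ℚ - x) * ((1ℚ - Y) * poly t g x + x ^ t * B)) x^2m≡X*X ⟩
    (1ℚ - x) * (1ℚ - x) * ((1ℚ - X * X) * poly t g x + x ^ t * B)
      ≡⟨ *-distribˡ-combination ((1ℚ - x) * (1ℚ - x)) (1ℚ - X * X) (poly t g x) (x ^ t) B ⟩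
    (1ℚ - X * X) * ((1ℚ - x) * (1ℚ - x) * poly t g x) + x ^ t * ((1ℚ - x) * (1ℚ - x) * B)
      ≡⟨ cong₂ (λ a b → (1ℚ - X * X) * a + x ^ t * b) prefix rest ⟩
    (1ℚ - X * X) * ((1ℚ - x) * ℕtoℚ t - x * (1ℚ - x ^ t)) + x ^ t * (x * (1ℚ - X) * (1ℚ - X)) ∎
    where
    open ≡-Reasoning
    g : ℕ → ℚ
    g n = ℕtoℚ (a⁻ n t m)
    B : ℚ
    B = poly (2 ℕ.* m) (λ n → g (t ℕ.+ n)) x
    periodic : ∀ n → n < t → g (2 ℕ.* m ℕ.+ n) ≡ g n
    periodic n n<t = cong ℕtoℚ (a⁻-2m+ k n<t t≤m)
    prefix : (1ℚ - x) * (1ℚ - x) * poly t g x ≡ (1ℚ - x) * ℕtoℚ t - x * (1ℚ - x ^ t)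
    prefix = trans (cong ((1ℚ - x) * (1ℚ - x) *_) (poly-cong t x (λ n n<t → cong ℕtoℚ (a⁻-≤ k (ℕₚ.<⇒≤ n<t) t≤m))))
                   (poly-descending t x)
    rest : (1ℚ - x) * (1ℚ - x) * B ≡ x * (1ℚ - X) * (1ℚ - X)
    rest = trans (cong ((1ℚ - x) * (1ℚ - x) *_) (poly-cong (2 ℕ.* m) x (λ n n<2m → cong ℕtoℚ (a⁻-t+ k t n<2m)))) poly-triangle

cancel-square : ∀ c y a b → c * y ≡ 1ℚ → c * c * a ≡ c * c * b → a ≡ b
cancel-square c y a b c*y≡1 c²a≡c²b = begin
  a                             ≡⟨ solve (a ∷ []) ℚ-ring ⟩
  1ℚ * 1ℚ * a                   ≡⟨ cong (λ e → e * e * a) c*y≡1 ⟨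
  (c * y) * (c * y) * a         ≡⟨ solve (c ∷ y ∷ a ∷ []) ℚ-ring ⟩
  y * y * (c * c * a)           ≡⟨ cong (y * y *_) c²a≡c²b ⟩
  y * y * (c * c * b)           ≡⟨ solve (c ∷ y ∷ b ∷ []) ℚ-ring ⟩
  (c * y) * (c * y) * b         ≡⟨ cong (λ e → e * e * b) c*y≡1 ⟩
  1ℚ * 1ℚ * b                   ≡⟨ solve (b ∷ []) ℚ-ring ⟩
  b                             ∎
  where open ≡-Reasoning

clear-denominators : ∀ x y → (1ℚ - x) * y ≡ 1ℚ → ∀ X a b c₁ c₂ →
  (1ℚ - x) * (1ℚ - x) * ((1ℚ - X) * y * (a * y - b * y + c₁ + c₂)) ≡ (1ℚ - X) * (a - b + (1ℚ - x) * (c₁ + c₂))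
clear-denominators x y e X a b c₁ c₂ = begin
  (1ℚ - x) * (1ℚ - x) * ((1ℚ - X) * y * (a * y - b * y + c₁ + c₂))
    ≡⟨ solve (x ∷ y ∷ X ∷ a ∷ b ∷ c₁ ∷ c₂ ∷ []) ℚ-ring ⟩
  (1ℚ - X) * ((1ℚ - x) * y * ((1ℚ - x) * y) * (a - b) + (1ℚ - x) * y * ((1ℚ - x) * (c₁ + c₂)))
    ≡⟨ cong (λ e → (1ℚ - X) * (e * e * (a - b) + e * ((1ℚ - x) * (c₁ + c₂)))) e ⟩
  (1ℚ - X) * (1ℚ * 1ℚ * (a - b) + 1ℚ * ((1ℚ - x) * (c₁ + c₂)))
    ≡⟨ solve (x ∷ X ∷ a ∷ b ∷ c₁ ∷ c₂ ∷ []) ℚ-ring ⟩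
  (1ℚ - X) * (a - b + (1ℚ - x) * (c₁ + c₂)) ∎
  where open ≡-Reasoning

closed-form⁺ : ∀ x X D D′ E W T T′ → D′ ≡ D → E ≡ D * (x * 1ℚ) → D * (x * W) ≡ X → T′ ≡ T - 1ℚ →
  (1ℚ - X) * (x * (1ℚ - D′) - E * (1ℚ - W) + (1ℚ - x) * (T′ * X + T))
    ≡ (1ℚ - X * X) * ((1ℚ - x) * T + x * (1ℚ - D)) - D * (x * (1ℚ - X) * (1ℚ - X))
closed-form⁺ x _ D _ _ W T _ refl refl refl refl = solve (x ∷ D ∷ W ∷ T ∷ []) ℚ-ring

closed-form⁻ : ∀ x X D D′ P E T → D′ ≡ D → E ≡ P * (x * 1ℚ) → P * D ≡ X →
  (1ℚ - X) * (E * (1ℚ - D′) - x * (1ℚ - P) + (1ℚ - x) * (T * X + T))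
    ≡ (1ℚ - X * X) * ((1ℚ - x) * T - x * (1ℚ - P)) + P * (x * (1ℚ - X) * (1ℚ - X))
closed-form⁻ x _ D _ P _ T refl refl refl = solve (x ∷ D ∷ P ∷ T ∷ []) ℚ-ring

module _ (x : ℚ) (x≢0 : x ≢ 0ℚ) where

  ipow-+-+ : ∀ {a b} → b ≤ a → ipow x x≢0 (+ a ℤ.- + b) ≡ x ^ (a ∸ b)
  ipow-+-+ b≤a = cong (ipow x x≢0) (+m-+n≡+[m∸n] b≤a)

  ipow-+-++1 : ∀ {a b} → b ≤ a → ipow x x≢0 (+ a ℤ.- + b ℤ.+ + 1) ≡ x ^ (a ∸ b) * (x * 1ℚ)
  ipow-+-++1 {a} {b} b≤a = trans (cong (λ i → ipow x x≢0 (i ℤ.+ + 1)) (+m-+n≡+[m∸n] b≤a)) (^-distribˡ-+-* x (a ∸ b) 1)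

  x*ipow[t-1]≡x^t : ∀ t → x * ipow x x≢0 (+ t ℤ.- + 1) ≡ x ^ t
  x*ipow[t-1]≡x^t zero    = trans (cong (x *_) (ℚₚ.*-identityʳ (1/ x))) (ℚₚ.*-inverseʳ x)
    where
    instance
      x-nonZero : NonZero x
      x-nonZero = ≢-nonZero x≢0
  x*ipow[t-1]≡x^t (suc t) = cong (λ i → x * ipow x x≢0 i) (+m-+n≡+[m∸n] {suc t} (s≤s z≤n))

theorem5p6 : (m t : ℕ) → 1 ≤ m → t ≤ m →
    (x : ℚ) (x≢0 : x ≢ 0ℚ) (x≢1 : x ≢ 1ℚ) →
    (f⁺ x t m ≡
      divBy (1ℚ - x ^ m) (1ℚ - x) (1-x≢0 x≢1) *
        ((divBy (x * (1ℚ - ipow x x≢0 (+ m ℤ.- + t))) (1ℚ - x) (1-x≢0 x≢1)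
          - divBy (ipow x x≢0 (+ m ℤ.- + t ℤ.+ + 1) * (1ℚ - ipow x x≢0 (+ t ℤ.- + 1))) (1ℚ - x) (1-x≢0 x≢1))
          + ((+ t ℤ.- + 1) / 1) * x ^ m
          + (+ t) / 1))
    × (f⁻ x t m ≡
      divBy (1ℚ - x ^ m) (1ℚ - x) (1-x≢0 x≢1) *
        ((divBy (ipow x x≢0 (+ t ℤ.+ + 1) * (1ℚ - ipow x x≢0 (+ m ℤ.- + t))) (1ℚ - x) (1-x≢0 x≢1)
          - divBy (x * (1ℚ - x ^ t)) (1ℚ - x) (1-x≢0 x≢1))
          + ((+ t) / 1) * x ^ m
          + (+ t) / 1))
theorem5p6 (suc k) t (s≤s z≤n) t≤m x x≢0 x≢1 =
    cancel-square (1ℚ - x) y _ _ inverse (trans (f⁺-numerator k x t≤m) (sym (trans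
      (clear-denominators x y inverse X (x * (1ℚ - D′)) (E⁺ * (1ℚ - W)) (T′ * X) T)
      (closed-form⁺ x X D D′ E⁺ W T T′ (ipow-+-+ x x≢0 t≤m) (ipow-+-++1 x x≢0 t≤m)
                    (trans (cong (D *_) (x*ipow[t-1]≡x^t x x≢0 t)) D*x^t≡X) ([i+j]/1≡i/1+j/1 (+ t) (ℤ.- + 1))))))
  , cancel-square (1ℚ - x) y _ _ inverse (trans (f⁻-numerator k x t≤m) (sym (trans
      (clear-denominators x y inverse X (E⁻ * (1ℚ - D′)) (x * (1ℚ - x ^ t)) (T * X) T)
      (closed-form⁻ x X D D′ (x ^ t) E⁻ T (ipow-+-+ x x≢0 t≤m) (^-distribˡ-+-* x t 1)
                    (trans (ℚₚ.*-comm (x ^ t) D) D*x^t≡X)))))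
  where
  instance
    1-x-nonZero : NonZero (1ℚ - x)
    1-x-nonZero = ≢-nonZero (1-x≢0 x≢1)
  m : ℕ
  m = suc k
  y : ℚ
  y = 1/ (1ℚ - x)
  inverse : (1ℚ - x) * y ≡ 1ℚ
  inverse = ℚₚ.*-inverseʳ (1ℚ - x)
  X D D′ E⁺ E⁻ W T T′ : ℚ
  X  = x ^ m
  D  = x ^ (m ∸ t)
  D′ = ipow x x≢0 (+ m ℤ.- + t)
  E⁺ = ipow x x≢0 (+ m ℤ.- + t ℤ.+ + 1)
  E⁻ = ipow x x≢0 (+ t ℤ.+ + 1)
  W  = ipow x x≢0 (+ t ℤ.- + 1)
  T  = ℕtoℚ t
  T′ = (+ t ℤ.- + 1) / 1
  D*x^t≡X : D * x ^ t ≡ X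
  D*x^t≡X = trans (sym (^-distribˡ-+-* x (m ∸ t) t)) (cong (x ^_) (ℕₚ.m∸n+n≡m t≤m))
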